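{- Let $G$ be a finite simple graph with exactly two holes $C_1$ and $C_2$. For $t\in\{1,2\}$ let $X_t$ be the set of vertices of $G$ adjacent to every vertex of $C_t$. Then both $X_1$ and $X_2$ are cliques of $G$.
   Context: A hole of a graph is an induced subgraph that is a cycle of length at least $4$. A clique is a set of pairwise adjacent vertices. -}

module Defs where

open import Data.Nat using (ℕ; suc; _+_; _%_)
open import Data.Fin using (Fin; toℕ)
open import Data.Fin.Subset using (Subset; _∈_)
open import Data.Product using (Σ; ∃; _×_)
open import Data.Sum using (_⊎_)
open import Function.Bundles using (_⇔_)
open import Function.Definitions using (Injective)
open import Relation.Nullary using (¬_; Dec)
open import Relation.Binary.PropositionalEquality using (_≡_; _≢_)

record Graph (n : ℕ) : Set₁ where
  field
    Adj    : Fin n → Fin n → Set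
    adj?   : ∀ x y → Dec (Adj x y)
    sym    : ∀ {x y} → Adj x y → Adj y x
    irrefl : ∀ x → ¬ Adj x x
open Graph public

CycAdj : (k : ℕ) → .{{_ : Data.Nat.NonZero k}} → Fin k → Fin k → Set
CycAdj k i j = (toℕ j ≡ (suc (toℕ i)) % k) ⊎ (toℕ i ≡ (suc (toℕ j)) % k)

-- S is (the vertex set of) a hole of G: the subgraph of G induced on S
-- is a cycle of length 4 + m ≥ 4, witnessed by a cyclic enumeration v of S.
IsHole : ∀ {n} → Graph n → Subset n → Set
IsHole {n} G S =
  Σ ℕ λ m → Σ (Fin (4 + m) → Fin n) λ v →
    Injective _≡_ _≡_ v ×
    (∀ x → (x ∈ S) ⇔ (∃ λ i → v i ≡ x)) ×
    (∀ i j → Adj G (v i) (v j) ⇔ CycAdj (4 + m) i j)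

ExactlyTwoHoles : ∀ {n} → Graph n → Subset n → Subset n → Set
ExactlyTwoHoles G C₁ C₂ =
  IsHole G C₁ × IsHole G C₂ × C₁ ≢ C₂ ×
  (∀ S → IsHole G S → S ≡ C₁ ⊎ S ≡ C₂)

CompleteTo : ∀ {n} → Graph n → Subset n → Fin n → Set
CompleteTo G C x = ∀ y → y ∈ C → Adj G x y

IsClique : ∀ {n} → Graph n → (Fin n → Set) → Set
IsClique G X = ∀ x y → X x → X y → x ≢ y → Adj G x y

-- If x and y are nonadjacent vertices complete to a hole C with first four
-- vertices v₀ v₁ v₂ v₃, then x v₀ y v₂ and x v₁ y v₃ are two further holes of
-- length 4. Neither is C, since x ∉ C, and they differ, since only the first
-- contains v₀; so G has at least three holes.

module Submission where

open import Defs
open import Data.Nat using (zero; suc; _+_)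
open import Data.Fin using (Fin)
open import Data.Fin.Patterns using (0F; 1F; 2F; 3F)
open import Data.Fin.Subset using (Subset; _∈_; _∉_; ⁅_⁆; _∪_)
open import Data.Fin.Subset.Properties using (x∈⁅x⁆; x∈⁅y⁆⇒x≡y; x∈p∪q⁻; p⊆p∪q; q⊆p∪q)
open import Data.Product using (_×_; _,_; ∃)
open import Data.Sum using (_⊎_; inj₁; inj₂; swap)
open import Data.Empty using (⊥-elim)
open import Function using (_∘_)
open import Function.Bundles using (_⇔_; mk⇔; Equivalence)
open import Relation.Nullary using (¬_; yes; no)
open import Relation.Binary.PropositionalEquality
  using (_≡_; _≢_; refl; trans; subst; ≢-sym)
  renaming (sym to ≡-sym)

adjacent⇒≢ : ∀ {n} (G : Graph n) {x y} → Adj G x y → x ≢ y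
adjacent⇒≢ G {x} xy refl = irrefl G x xy

completeTo⇒∉ : ∀ {n} (G : Graph n) {C x} → CompleteTo G C x → x ∉ C
completeTo⇒∉ G {x = x} X x∈C = irrefl G x (X x x∈C)

completeTo⇒≢ : ∀ {n} (G : Graph n) {C x y} → CompleteTo G C x → y ∈ C → x ≢ y
completeTo⇒≢ G X y∈C = adjacent⇒≢ G (X _ y∈C)

Square : ∀ {n} → Fin n → Fin n → Fin n → Fin n → Subset n
Square a b c d = ⁅ a ⁆ ∪ ⁅ b ⁆ ∪ ⁅ c ⁆ ∪ ⁅ d ⁆

square : ∀ {n} → Fin n → Fin n → Fin n → Fin n → Fin 4 → Fin n
square a b c d 0F = a
square a b c d 1F = b
square a b c d 2F = c
square a b c d 3F = d

∈-Square⁺ : ∀ {n} (a b c d : Fin n) i → square a b c d i ∈ Square a b c d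
∈-Square⁺ a b c d 0F = p⊆p∪q _ (x∈⁅x⁆ a)
∈-Square⁺ a b c d 1F = q⊆p∪q ⁅ a ⁆ _ (p⊆p∪q _ (x∈⁅x⁆ b))
∈-Square⁺ a b c d 2F = q⊆p∪q ⁅ a ⁆ _ (q⊆p∪q ⁅ b ⁆ _ (p⊆p∪q _ (x∈⁅x⁆ c)))
∈-Square⁺ a b c d 3F = q⊆p∪q ⁅ a ⁆ _ (q⊆p∪q ⁅ b ⁆ _ (q⊆p∪q ⁅ c ⁆ _ (x∈⁅x⁆ d)))

∈-Square⁻ : ∀ {n} (a b c d : Fin n) {z} → z ∈ Square a b c d → ∃ λ i → square a b c d i ≡ z
∈-Square⁻ a b c d z∈ with x∈p∪q⁻ ⁅ a ⁆ _ z∈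
... | inj₁ z∈a = 0F , ≡-sym (x∈⁅y⁆⇒x≡y a z∈a)
... | inj₂ z∈bcd with x∈p∪q⁻ ⁅ b ⁆ _ z∈bcd
...   | inj₁ z∈b = 1F , ≡-sym (x∈⁅y⁆⇒x≡y b z∈b)
...   | inj₂ z∈cd with x∈p∪q⁻ ⁅ c ⁆ _ z∈cd
...     | inj₁ z∈c = 2F , ≡-sym (x∈⁅y⁆⇒x≡y c z∈c)
...     | inj₂ z∈d = 3F , ≡-sym (x∈⁅y⁆⇒x≡y d z∈d)

∉-Square : ∀ {n} {a b c d z : Fin n} →
  z ≢ a → z ≢ b → z ≢ c → z ≢ d → z ∉ Square a b c d
∉-Square {a = a} {b} {c} {d} z≢a z≢b z≢c z≢d z∈ with ∈-Square⁻ a b c d z∈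
... | 0F , e = z≢a (≡-sym e)
... | 1F , e = z≢b (≡-sym e)
... | 2F , e = z≢c (≡-sym e)
... | 3F , e = z≢d (≡-sym e)

both : ∀ {p q} {P : Set p} {Q : Set q} → P → Q → P ⇔ Q
both p q = mk⇔ (λ _ → q) (λ _ → p)

neither : ∀ {p q} {P : Set p} {Q : Set q} → ¬ P → ¬ Q → P ⇔ Q
neither ¬p ¬q = mk⇔ (⊥-elim ∘ ¬p) (⊥-elim ∘ ¬q)

module InducedSquare {n} (G : Graph n) {a b c d : Fin n}
  (a≢c : a ≢ c) (b≢d : b ≢ d)
  (ab : Adj G a b) (bc : Adj G b c) (cd : Adj G c d) (da : Adj G d a)
  (¬ac : ¬ Adj G a c) (¬bd : ¬ Adj G b d) where

  v : Fin 4 → Fin n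
  v = square a b c d

  a≢b : a ≢ b
  a≢b = adjacent⇒≢ G ab
  b≢c : b ≢ c
  b≢c = adjacent⇒≢ G bc
  c≢d : c ≢ d
  c≢d = adjacent⇒≢ G cd
  a≢d : a ≢ d
  a≢d = ≢-sym (adjacent⇒≢ G da)

  injective : ∀ {i j} → v i ≡ v j → i ≡ j
  injective {0F} {0F} _ = refl
  injective {0F} {1F} e = ⊥-elim (a≢b e)
  injective {0F} {2F} e = ⊥-elim (a≢c e)
  injective {0F} {3F} e = ⊥-elim (a≢d e)
  injective {1F} {0F} e = ⊥-elim (a≢b (≡-sym e))
  injective {1F} {1F} _ = refl
  injective {1F} {2F} e = ⊥-elim (b≢c e)
  injective {1F} {3F} e = ⊥-elim (b≢d e)
  injective {2F} {0F} e = ⊥-elim (a≢c (≡-sym e))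
  injective {2F} {1F} e = ⊥-elim (b≢c (≡-sym e))
  injective {2F} {2F} _ = refl
  injective {2F} {3F} e = ⊥-elim (c≢d e)
  injective {3F} {0F} e = ⊥-elim (a≢d (≡-sym e))
  injective {3F} {1F} e = ⊥-elim (b≢d (≡-sym e))
  injective {3F} {2F} e = ⊥-elim (c≢d (≡-sym e))
  injective {3F} {3F} _ = refl

  adjacency : ∀ i j → Adj G (v i) (v j) ⇔ CycAdj 4 i j
  adjacency 0F 0F = neither (irrefl G a) λ { (inj₁ ()) ; (inj₂ ()) }
  adjacency 0F 1F = both ab (inj₁ refl)
  adjacency 0F 2F = neither ¬ac λ { (inj₁ ()) ; (inj₂ ()) }
  adjacency 0F 3F = both (sym G da) (inj₂ refl)
  adjacency 1F 0F = both (sym G ab) (inj₂ refl)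
  adjacency 1F 1F = neither (irrefl G b) λ { (inj₁ ()) ; (inj₂ ()) }
  adjacency 1F 2F = both bc (inj₁ refl)
  adjacency 1F 3F = neither ¬bd λ { (inj₁ ()) ; (inj₂ ()) }
  adjacency 2F 0F = neither (¬ac ∘ sym G) λ { (inj₁ ()) ; (inj₂ ()) }
  adjacency 2F 1F = both (sym G bc) (inj₂ refl)
  adjacency 2F 2F = neither (irrefl G c) λ { (inj₁ ()) ; (inj₂ ()) }
  adjacency 2F 3F = both cd (inj₁ refl)
  adjacency 3F 0F = both da (inj₁ refl)
  adjacency 3F 1F = neither (¬bd ∘ sym G) λ { (inj₁ ()) ; (inj₂ ()) }
  adjacency 3F 2F = both (sym G cd) (inj₂ refl)
  adjacency 3F 3F = neither (irrefl G d) λ { (inj₁ ()) ; (inj₂ ()) }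

  isHole : IsHole G (Square a b c d)
  isHole = 0 , v , injective
         , (λ _ → mk⇔ (∈-Square⁻ a b c d) λ { (i , refl) → ∈-Square⁺ a b c d i })
         , adjacency

record NonEdgeIn {n} (G : Graph n) (C : Subset n) (a b : Fin n) : Set where
  field
    ∈ˡ          : a ∈ C
    ∈ʳ          : b ∈ C
    distinct    : a ≢ b
    nonadjacent : ¬ Adj G a b

¬CycAdj-0-2 : ∀ m → ¬ CycAdj (4 + m) 0F 2F
¬CycAdj-0-2 m (inj₁ ())
¬CycAdj-0-2 m (inj₂ ())

¬CycAdj-1-3 : ∀ m → ¬ CycAdj (4 + m) 1F 3F
¬CycAdj-1-3 zero    (inj₁ ())
¬CycAdj-1-3 zero    (inj₂ ())
¬CycAdj-1-3 (suc m) (inj₁ ())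
¬CycAdj-1-3 (suc m) (inj₂ ())

hole-diagonals : ∀ {n} (G : Graph n) {C} → IsHole G C →
  ∃ λ a → ∃ λ b → ∃ λ c → ∃ λ d →
    NonEdgeIn G C a c × NonEdgeIn G C b d × a ≢ b × a ≢ d
hole-diagonals G (m , v , inj , mem , adj) =
  v 0F , v 1F , v 2F , v 3F
  , record { ∈ˡ = ∈C 0F ; ∈ʳ = ∈C 2F ; distinct = (λ ()) ∘ inj
           ; nonadjacent = ¬CycAdj-0-2 m ∘ Equivalence.to (adj 0F 2F) }
  , record { ∈ˡ = ∈C 1F ; ∈ʳ = ∈C 3F ; distinct = (λ ()) ∘ inj
           ; nonadjacent = ¬CycAdj-1-3 m ∘ Equivalence.to (adj 1F 3F) }
  , (λ ()) ∘ inj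
  , (λ ()) ∘ inj
  where
  ∈C : ∀ i → v i ∈ _
  ∈C i = Equivalence.from (mem (v i)) (i , refl)

completeTo-square-isHole : ∀ {n} (G : Graph n) {C x y a b} →
  CompleteTo G C x → CompleteTo G C y → x ≢ y → ¬ Adj G x y →
  NonEdgeIn G C a b → IsHole G (Square x a y b)
completeTo-square-isHole G X Y x≢y ¬xy ab =
  InducedSquare.isHole G x≢y distinct
    (X _ ∈ˡ) (sym G (Y _ ∈ˡ)) (Y _ ∈ʳ) (sym G (X _ ∈ʳ)) ¬xy nonadjacent
  where open NonEdgeIn ab

holes-avoiding-coincide : ∀ {n} (G : Graph n) {C D S T : Subset n} →
  (∀ H → IsHole G H → H ≡ C ⊎ H ≡ D) →
  IsHole G S → IsHole G T → S ≢ C → T ≢ C → S ≡ T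
holes-avoiding-coincide G classify hS hT S≢C T≢C
  with classify _ hS | classify _ hT
... | inj₁ S≡C | _        = ⊥-elim (S≢C S≡C)
... | _        | inj₁ T≡C = ⊥-elim (T≢C T≡C)
... | inj₂ S≡D | inj₂ T≡D = trans S≡D (≡-sym T≡D)

completeTo-hole-isClique : ∀ {n} (G : Graph n) {C D : Subset n} → IsHole G C →
  (∀ H → IsHole G H → H ≡ C ⊎ H ≡ D) → IsClique G (CompleteTo G C)
completeTo-hole-isClique G {C} hole classify x y X Y x≢y
  with adj? G x y | hole-diagonals G hole
... | yes xy | _ = xy
... | no ¬xy | a , b , c , d , ac , bd , a≢b , a≢d =
  ⊥-elim (a∉S′ (subst (a ∈_) S≡S′ (∈-Square⁺ x a y c 1F)))
  where
  open NonEdgeIn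
  ≢C : ∀ {p q r} → Square x p q r ≢ C
  ≢C {p} {q} {r} S≡C = completeTo⇒∉ G X (subst (x ∈_) S≡C (∈-Square⁺ x p q r 0F))
  a∉S′ : a ∉ Square x b y d
  a∉S′ = ∉-Square (≢-sym (completeTo⇒≢ G X (ac .∈ˡ))) a≢b
                  (≢-sym (completeTo⇒≢ G Y (ac .∈ˡ))) a≢d
  hole-through : ∀ {p q} → NonEdgeIn G C p q → IsHole G (Square x p y q)
  hole-through = completeTo-square-isHole G X Y x≢y ¬xy
  S≡S′ : Square x a y c ≡ Square x b y d
  S≡S′ = holes-avoiding-coincide G classify
    (hole-through ac) (hole-through bd) ≢C ≢C

lemma9 : ∀ {n} (G : Graph n) (C₁ C₂ : Subset n) →
    ExactlyTwoHoles G C₁ C₂ →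
    IsClique G (CompleteTo G C₁) × IsClique G (CompleteTo G C₂)
lemma9 G C₁ C₂ (hole₁ , hole₂ , _ , classify) =
    completeTo-hole-isClique G hole₁ classify
  , completeTo-hole-isClique G hole₂ (λ S hole → swap (classify S hole))
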